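{- For $n\geq 2$, $a_n(321;231) = n-1$.
   Context: $\mathcal{S}_n$ is the set of permutations of $[n]=\{1,\dots,n\}$, written in one-line notation $\pi=\pi_1\pi_2\cdots\pi_n$ with $\pi_i=\pi(i)$. A permutation is cyclic if it consists of exactly one $n$-cycle. For a cyclic $\pi$, its standard cycle notation is $C(\pi)=(c_1,c_2,\dots,c_n)$ with $c_1=1$ and $c_i=\pi_{c_{i-1}}$ for $2\le i\le n$. A sequence of distinct integers $w_1\cdots w_m$ contains a pattern $\sigma\in\mathcal{S}_k$ if there are indices $i_1<\dots<i_k$ with $w_{i_1}\cdots w_{i_k}$ in the same relative order as $\sigma_1\cdots\sigma_k$; otherwise it avoids $\sigma$. For $\sigma,\tau\in\mathcal{S}_3$, $\mathcal{A}_n(\sigma;\tau)$ is the set of cyclic permutations $\pi\in\mathcal{S}_n$ whose one-line notation avoids $\sigma$ and whose cycle notation $C(\pi)$ (as the sequence $c_1c_2\cdots c_n$) avoids $\tau$; $a_n(\sigma;\tau)=|\mathcal{A}_n(\sigma;\tau)|$. -}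

module Defs where

open import Data.Nat using (ℕ; zero; suc)
open import Data.Fin using (Fin; toℕ; _<_) renaming (zero to fzero; suc to fsuc)
open import Data.Vec using (Vec; []; lookup; tabulate)
open import Data.List using (List; length)
open import Data.List.Membership.Propositional using (_∈_)
open import Data.List.Relation.Unary.Unique.Propositional using (Unique)
open import Data.Product using (Σ; ∃-syntax; _×_)
open import Data.Empty using (⊥)
open import Relation.Nullary using (¬_)
open import Relation.Binary.PropositionalEquality using (_≡_)
open import Function.Bundles using (_⇔_)

-- Convention: [n] = {1,…,n} is represented by Fin n (0-based), so the
-- element 1 is fzero.  Sequences are vectors.

iter : {A : Set} → (A → A) → ℕ → A → A
iter f zero    x = x
iter f (suc k) x = f (iter f k x)

IsPerm : {n : ℕ} → Vec (Fin n) n → Set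
IsPerm {n} v = ∀ (i j : Fin n) → lookup v i ≡ lookup v j → i ≡ j

-- cyclic: consists of exactly one n-cycle, i.e. every element lies in
-- the orbit of every element
IsCyclic : {n : ℕ} → Vec (Fin n) n → Set
IsCyclic {n} v = ∀ (i j : Fin n) → ∃[ k ] (iter (lookup v) k i ≡ j)

-- standard cycle notation C(π) = (c₁,…,cₙ), c₁ = 1, cᵢ = π(cᵢ₋₁),
-- i.e. cᵢ = π^{i-1}(1)
cycleNotation : {n : ℕ} → Vec (Fin n) n → Vec (Fin n) n
cycleNotation {zero}  v = []
cycleNotation {suc n} v = tabulate (λ i → iter (lookup v) (toℕ i) fzero)

Contains : {m k N : ℕ} → Vec (Fin N) m → Vec (Fin k) k → Set
Contains {m} {k} w σ =
  Σ (Fin k → Fin m) λ ι →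
      ((a b : Fin k) → a < b → ι a < ι b)
    × ((a b : Fin k) → (lookup w (ι a) < lookup w (ι b)) ⇔ (lookup σ a < lookup σ b))

Avoids : {m k N : ℕ} → Vec (Fin N) m → Vec (Fin k) k → Set
Avoids w σ = ¬ Contains w σ

-- patterns of S₃ (0-based values)
p321 p231 : Vec (Fin 3) 3
p321 = fsuc (fsuc fzero) Data.Vec.∷ fsuc fzero Data.Vec.∷ fzero Data.Vec.∷ []
p231 = fsuc fzero Data.Vec.∷ fsuc (fsuc fzero) Data.Vec.∷ fzero Data.Vec.∷ []

InA : (n : ℕ) → Vec (Fin 3) 3 → Vec (Fin 3) 3 → Vec (Fin n) n → Set
InA n σ τ π = IsPerm π × IsCyclic π × Avoids π σ × Avoids (cycleNotation π) τ

HasCardinality : {A : Set} → (A → Set) → ℕ → Set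
HasCardinality {A} P k =
  Σ (List A) λ L → Unique L × (∀ x → (x ∈ L) ⇔ P x) × (length L ≡ k)

-- Write n = m + 2 and number positions and values 0, …, m + 1.  Let π be cyclic with
-- C(π) avoiding 231 and π avoiding 321.  Since C(π) starts with its minimum and avoids
-- 231, every entry of C(π) before the maximum m + 1 is smaller than every entry after
-- it.  So if q is the entry just before m + 1 and p the last entry of C(π), then
-- π(q) = m + 1, π(p) = 0 and q < p; avoiding 321 forces p = q + 1 and makes π increasing
-- on 0…q and on q+1…m+1.  The entries below q precede m + 1 in C(π), so π maps 0…q-1
-- increasingly into 1…q, and then q+2…m+1 increasingly into q+1…m: π is pinned down as
-- 1 2 … q (m+1) 0 (q+1) … m, with C(π) = 0 1 … q (m+1) m … (q+1).  Conversely each of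
-- these m + 1 permutations qualifies.

module Submission where

open import Defs
open import Data.Nat using (ℕ; zero; suc; _+_; _∸_; pred; _≤_; _<_; z≤n; s≤s; z<s; _≤?_; _<?_; >-nonZero)
open import Data.Nat.Properties
open import Data.Fin as F using (Fin; toℕ; fromℕ<) renaming (zero to fzero; suc to fsuc)
open import Data.Fin.Properties using (toℕ-injective; toℕ<n; toℕ-fromℕ<; injective⇒≤; pigeonhole; all?)
open import Data.Vec using (Vec; lookup; tabulate)
open import Data.Vec.Properties using (lookup∘tabulate; tabulate∘lookup; tabulate-cong)
open import Data.List using (map; allFin)
open import Data.List.Membership.Propositional using (_∈_)
open import Data.List.Properties using (length-map; length-tabulate)
open import Data.List.Membership.Propositional.Properties using (∈-map⁺; ∈-map⁻; ∈-allFin)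
open import Data.List.Relation.Unary.Unique.Propositional.Properties using (map⁺; allFin⁺)
open import Data.Product using (∃-syntax; _×_; _,_; proj₁; proj₂)
open import Data.Sum using (inj₁; inj₂)
open import Data.Unit using (tt)
open import Data.Empty using (⊥; ⊥-elim)
open import Function using (_∘_)
open import Function.Bundles using (_⇔_; mk⇔; Equivalence)
open import Relation.Nullary using (¬_; Dec; yes; no; contradiction)
open import Relation.Nullary.Decidable using (_→-dec_; toWitness)
open import Relation.Binary.Definitions using (tri<; tri≈; tri>)
open import Relation.Binary.PropositionalEquality
  using (_≡_; _≢_; refl; sym; trans; cong; subst; subst₂; module ≡-Reasoning)

open ≡-Reasoning

clamp : (k x : ℕ) → Fin (suc k)
clamp k x = fromℕ< (s≤s (m⊓n≤n x k))

toℕ-clamp : ∀ {k x} → x ≤ k → toℕ (clamp k x) ≡ x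
toℕ-clamp x≤k = trans (toℕ-fromℕ< _) (m≤n⇒m⊓n≡m x≤k)

clamp-toℕ : ∀ {k} (x : Fin (suc k)) → clamp k (toℕ x) ≡ x
clamp-toℕ x = toℕ-injective (toℕ-clamp (≤-pred (toℕ<n x)))

lookup-ext : ∀ {A : Set} {n} {xs ys : Vec A n} → (∀ i → lookup xs i ≡ lookup ys i) → xs ≡ ys
lookup-ext {xs = xs} {ys} eq =
  trans (sym (tabulate∘lookup xs)) (trans (tabulate-cong eq) (tabulate∘lookup ys))

increasing-translation : (h : ℕ → ℕ) (c len : ℕ) →
  (∀ i → suc i < len → h i < h (suc i)) →
  (∀ i → i < len → c ≤ h i) →
  (∀ i → i < len → h i < c + len) →
  ∀ i → i < len → h i ≡ c + i
increasing-translation h c len increasing lower upper i i<len =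
  ≤-antisym (from-above (len ∸ suc i) i (m∸n+n≡m i<len)) (from-below i i<len)
  where
  from-below : ∀ i → i < len → c + i ≤ h i
  from-below zero    0<len   = subst (_≤ h 0) (sym (+-identityʳ c)) (lower 0 0<len)
  from-below (suc i) 1+i<len = subst (_≤ h (suc i)) (sym (+-suc c i))
    (≤-<-trans (from-below i (<-trans (n<1+n i) 1+i<len)) (increasing i 1+i<len))

  tighten : ∀ {x} i → x < c + suc i → x ≤ c + i
  tighten {x} i x< = ≤-pred (subst (x <_) (+-suc c i) x<)

  from-above : ∀ k i → k + suc i ≡ len → h i ≤ c + i
  from-above zero    i e = tighten i (subst (λ l → h i < c + l) (sym e) (upper i (subst (i <_) e (n<1+n i))))
  from-above (suc k) i e = tighten i (<-≤-trans (increasing i 1+i<len) (from-above k (suc i) e′))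
    where
    e′ : k + suc (suc i) ≡ len
    e′ = trans (+-suc k (suc i)) e
    1+i<len : suc i < len
    1+i<len = subst (suc i <_) e (s≤s (m≤n+m (suc i) k))

-- Occurrences of patterns of length three

isPerm? : ∀ {n} (v : Vec (Fin n) n) → Dec (IsPerm v)
isPerm? v = all? λ i → all? λ j → (lookup v i F.≟ lookup v j) →-dec (i F.≟ j)

p321-isPerm : IsPerm p321
p321-isPerm = toWitness {a? = isPerm? p321} tt

p231-isPerm : IsPerm p231
p231-isPerm = toWitness {a? = isPerm? p231} tt

-- Only one direction of each equivalence is required: σ is injective, so the
-- converse follows by trichotomy.
contains-by-order : ∀ {k M N} (σ : Vec (Fin k) k) → IsPerm σ → (w : Vec (Fin N) M)
  (ι : Fin k → Fin M) →
  (∀ a b → toℕ a < toℕ b → toℕ (ι a) < toℕ (ι b)) →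
  (∀ a b → toℕ (lookup σ a) < toℕ (lookup σ b) → toℕ (lookup w (ι a)) < toℕ (lookup w (ι b))) →
  Contains w σ
contains-by-order σ σ-perm w ι ι-increasing order = ι , ι-increasing , λ a b → mk⇔ (reflect a b) (order a b)
  where
  reflect : ∀ a b → toℕ (lookup w (ι a)) < toℕ (lookup w (ι b)) → toℕ (lookup σ a) < toℕ (lookup σ b)
  reflect a b wa<wb with <-cmp (toℕ (lookup σ a)) (toℕ (lookup σ b))
  ... | tri< σa<σb _ _ = σa<σb
  ... | tri> _ _ σb<σa = contradiction (order b a σb<σa) (<-asym wa<wb)
  ... | tri≈ _ σa≡σb _ with σ-perm a b (toℕ-injective σa≡σb)
  ...   | refl = contradiction wa<wb (<-irrefl refl)

triple : ∀ {M} → Fin M → Fin M → Fin M → Fin 3 → Fin M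
triple i j k fzero               = i
triple i j k (fsuc fzero)        = j
triple i j k (fsuc (fsuc fzero)) = k

triple-increasing : ∀ {M} {i j k : Fin M} → toℕ i < toℕ j → toℕ j < toℕ k →
  ∀ a b → toℕ a < toℕ b → toℕ (triple i j k a) < toℕ (triple i j k b)
triple-increasing i<j j<k fzero        (fsuc fzero)        _ = i<j
triple-increasing i<j j<k fzero        (fsuc (fsuc fzero)) _ = <-trans i<j j<k
triple-increasing i<j j<k (fsuc fzero) (fsuc (fsuc fzero)) _ = j<k
triple-increasing _ _ fzero               fzero               ()
triple-increasing _ _ (fsuc fzero)        fzero               ()
triple-increasing _ _ (fsuc fzero)        (fsuc fzero)        (s≤s ())
triple-increasing _ _ (fsuc (fsuc fzero)) fzero               ()
triple-increasing _ _ (fsuc (fsuc fzero)) (fsuc fzero)        (s≤s ())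
triple-increasing _ _ (fsuc (fsuc fzero)) (fsuc (fsuc fzero)) (s≤s (s≤s ()))

module _ {M N : ℕ} (w : Vec (Fin N) M) where

  private
    _≺_ : Fin M → Fin M → Set
    i ≺ j = toℕ (lookup w i) < toℕ (lookup w j)

  Occurrence321 Occurrence231 : Set
  Occurrence321 = ∃[ i ] ∃[ j ] ∃[ k ] toℕ i < toℕ j × toℕ j < toℕ k × j ≺ i × k ≺ j
  Occurrence231 = ∃[ i ] ∃[ j ] ∃[ k ] toℕ i < toℕ j × toℕ j < toℕ k × i ≺ j × k ≺ i

  contains321⇔ : Contains w p321 ⇔ Occurrence321
  contains321⇔ = mk⇔ extract build
    where
    extract : Contains w p321 → Occurrence321
    extract (ι , ι-increasing , order) =
      ι fzero , ι (fsuc fzero) , ι (fsuc (fsuc fzero)) ,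
      ι-increasing fzero (fsuc fzero) (s≤s z≤n) ,
      ι-increasing (fsuc fzero) (fsuc (fsuc fzero)) (s≤s (s≤s z≤n)) ,
      Equivalence.from (order (fsuc fzero) fzero) (s≤s (s≤s z≤n)) ,
      Equivalence.from (order (fsuc (fsuc fzero)) (fsuc fzero)) (s≤s z≤n)
    build : Occurrence321 → Contains w p321
    build (i , j , k , i<j , j<k , j≺i , k≺j) =
      contains-by-order p321 p321-isPerm w (triple i j k) (triple-increasing i<j j<k) order
      where
      order : ∀ a b → toℕ (lookup p321 a) < toℕ (lookup p321 b) → triple i j k a ≺ triple i j k b
      order (fsuc fzero)        fzero               _ = j≺i
      order (fsuc (fsuc fzero)) fzero               _ = <-trans k≺j j≺i
      order (fsuc (fsuc fzero)) (fsuc fzero)        _ = k≺j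
      order fzero               fzero               (s≤s (s≤s ()))
      order fzero               (fsuc fzero)        (s≤s ())
      order fzero               (fsuc (fsuc fzero)) ()
      order (fsuc fzero)        (fsuc fzero)        (s≤s ())
      order (fsuc fzero)        (fsuc (fsuc fzero)) ()
      order (fsuc (fsuc fzero)) (fsuc (fsuc fzero)) ()

  contains231⇔ : Contains w p231 ⇔ Occurrence231
  contains231⇔ = mk⇔ extract build
    where
    extract : Contains w p231 → Occurrence231
    extract (ι , ι-increasing , order) =
      ι fzero , ι (fsuc fzero) , ι (fsuc (fsuc fzero)) ,
      ι-increasing fzero (fsuc fzero) (s≤s z≤n) ,
      ι-increasing (fsuc fzero) (fsuc (fsuc fzero)) (s≤s (s≤s z≤n)) ,
      Equivalence.from (order fzero (fsuc fzero)) (s≤s (s≤s z≤n)) ,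
      Equivalence.from (order (fsuc (fsuc fzero)) fzero) (s≤s z≤n)
    build : Occurrence231 → Contains w p231
    build (i , j , k , i<j , j<k , i≺j , k≺i) =
      contains-by-order p231 p231-isPerm w (triple i j k) (triple-increasing i<j j<k) order
      where
      order : ∀ a b → toℕ (lookup p231 a) < toℕ (lookup p231 b) → triple i j k a ≺ triple i j k b
      order fzero               (fsuc fzero)        _ = i≺j
      order (fsuc (fsuc fzero)) fzero               _ = k≺i
      order (fsuc (fsuc fzero)) (fsuc fzero)        _ = <-trans k≺i i≺j
      order fzero               fzero               (s≤s ())
      order fzero               (fsuc (fsuc fzero)) ()
      order (fsuc fzero)        fzero               (s≤s ())
      order (fsuc fzero)        (fsuc fzero)        (s≤s (s≤s ()))
      order (fsuc fzero)        (fsuc (fsuc fzero)) ()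
      order (fsuc (fsuc fzero)) (fsuc (fsuc fzero)) ()

  twoRuns⇒avoids321 : (q : ℕ) →
    (∀ i j → toℕ i < toℕ j → toℕ j ≤ q → i ≺ j) →
    (∀ i j → q < toℕ i → toℕ i < toℕ j → i ≺ j) →
    Avoids w p321
  twoRuns⇒avoids321 q first second w⊇321 with Equivalence.to contains321⇔ w⊇321
  ... | i , j , k , i<j , j<k , j≺i , k≺j with toℕ j ≤? q
  ...   | yes j≤q = <-asym j≺i (first i j i<j j≤q)
  ...   | no  j≰q = <-asym k≺j (second j k (≰⇒> j≰q) j<k)

  prefixBelow-suffixDecreasing⇒avoids231 : (q : ℕ) →
    (∀ i k → toℕ i ≤ q → toℕ i < toℕ k → i ≺ k) →
    (∀ j k → q < toℕ j → toℕ j < toℕ k → k ≺ j) →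
    Avoids w p231
  prefixBelow-suffixDecreasing⇒avoids231 q prefix suffix w⊇231 with Equivalence.to contains231⇔ w⊇231
  ... | i , j , k , i<j , j<k , i≺j , k≺i with toℕ i ≤? q
  ...   | yes i≤q = <-asym k≺i (prefix i k i≤q (<-trans i<j j<k))
  ...   | no  i≰q = <-asym i≺j (suffix i j (≰⇒> i≰q) i<j)

-- Orbits of a cyclic map

module _ {A : Set} (f : A → A) where

  iter-+ : ∀ a b x → iter f (a + b) x ≡ iter f a (iter f b x)
  iter-+ zero    b x = refl
  iter-+ (suc a) b x = cong f (iter-+ a b x)

  iter-injective : (∀ {x y} → f x ≡ f y → x ≡ y) → ∀ k {x y} → iter f k x ≡ iter f k y → x ≡ y
  iter-injective f-injective zero    e = e
  iter-injective f-injective (suc k) e = iter-injective f-injective k (f-injective e)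

  returning-orbit⇒cyclic : ∀ z N → iter f N z ≡ z → (∀ y → ∃[ s ] s ≤ N × iter f s z ≡ y) →
    ∀ x y → ∃[ k ] iter f k x ≡ y
  returning-orbit⇒cyclic z N return cover x y with cover x | cover y
  ... | s , s≤N , refl | t , _ , refl = t + (N ∸ s) , (begin
    iter f (t + (N ∸ s)) (iter f s z) ≡⟨ iter-+ t (N ∸ s) _ ⟩
    iter f t (iter f (N ∸ s) (iter f s z)) ≡⟨ cong (iter f t) (sym (iter-+ (N ∸ s) s z)) ⟩
    iter f t (iter f (N ∸ s + s) z) ≡⟨ cong (λ e → iter f t (iter f e z)) (m∸n+n≡m s≤N) ⟩
    iter f t (iter f N z) ≡⟨ cong (iter f t) return ⟩
    iter f t z ∎)

module CyclicOrbit {n : ℕ} (f : Fin n → Fin n) (f-injective : ∀ {x y} → f x ≡ f y → x ≡ y)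
                   (cyclic : ∀ x y → ∃[ k ] iter f k x ≡ y) (z : Fin n) where

  orbit : ℕ → Fin n
  orbit k = iter f k z

  period-reduce : ∀ {d} → orbit d ≡ z → 0 < d → ∀ k → ∃[ s ] s < d × orbit s ≡ orbit k
  period-reduce od≡z 0<d zero = 0 , 0<d , refl
  period-reduce od≡z 0<d (suc k) with period-reduce od≡z 0<d k
  ... | s , s<d , os≡ok with m≤n⇒m<n∨m≡n s<d
  ...   | inj₁ 1+s<d = suc s , 1+s<d , cong f os≡ok
  ...   | inj₂ 1+s≡d = 0 , 0<d , trans (sym od≡z) (trans (cong orbit (sym 1+s≡d)) (cong f os≡ok))

  period-covers : ∀ {d} → orbit d ≡ z → 0 < d → ∀ y → ∃[ s ] s < d × orbit s ≡ y
  period-covers od≡z 0<d y with cyclic z y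
  ... | k , ok≡y with period-reduce od≡z 0<d k
  ...   | s , s<d , os≡ok = s , s<d , trans os≡ok ok≡y

  period-≥ : ∀ {d} → orbit d ≡ z → 0 < d → n ≤ d
  period-≥ {d} od≡z 0<d = injective⇒≤ {f = position} λ {x} {y} e →
    trans (sym (orbit-position x)) (trans (cong (orbit ∘ toℕ) e) (orbit-position y))
    where
    position : Fin n → Fin d
    position y = fromℕ< (proj₁ (proj₂ (period-covers od≡z 0<d y)))
    orbit-position : ∀ y → orbit (toℕ (position y)) ≡ y
    orbit-position y = trans (cong orbit (toℕ-fromℕ< (proj₁ (proj₂ c)))) (proj₂ (proj₂ c))
      where c = period-covers od≡z 0<d y

  orbit-difference : ∀ {i j} → i ≤ j → orbit i ≡ orbit j → orbit (j ∸ i) ≡ z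
  orbit-difference {i} {j} i≤j oi≡oj = iter-injective f f-injective i (begin
    iter f i (orbit (j ∸ i)) ≡⟨ sym (iter-+ f i (j ∸ i) z) ⟩
    orbit (i + (j ∸ i))      ≡⟨ cong orbit (m+[n∸m]≡n i≤j) ⟩
    orbit j                  ≡⟨ sym oi≡oj ⟩
    orbit i                  ∎)

  orbit-injective-< : ∀ {i j} → i < j → j < n → orbit i ≢ orbit j
  orbit-injective-< {i} {j} i<j j<n oi≡oj =
    <⇒≱ j<n (≤-trans (period-≥ (orbit-difference (<⇒≤ i<j) oi≡oj) (m<n⇒0<n∸m i<j)) (m∸n≤m j i))

  orbit-injective : ∀ {i j} → i < n → j < n → orbit i ≡ orbit j → i ≡ j
  orbit-injective {i} {j} i<n j<n oi≡oj with <-cmp i j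
  ... | tri< i<j _ _ = contradiction oi≡oj (orbit-injective-< i<j j<n)
  ... | tri≈ _ i≡j _ = i≡j
  ... | tri> _ _ j<i = contradiction (sym oi≡oj) (orbit-injective-< j<i i<n)

  -- Two of the n + 1 points orbit 0, …, orbit n coincide, giving a period of at most n.
  orbit-return : orbit n ≡ z
  orbit-return with pigeonhole (n<1+n n) (orbit ∘ toℕ)
  ... | i , j , i<j , oi≡oj = subst (λ d → orbit d ≡ z) d≡n (orbit-difference (<⇒≤ i<j) oi≡oj)
    where
    d≡n : toℕ j ∸ toℕ i ≡ n
    d≡n = ≤-antisym (≤-trans (m∸n≤m (toℕ j) (toℕ i)) (≤-pred (toℕ<n j)))
                    (period-≥ (orbit-difference (<⇒≤ i<j) oi≡oj) (m<n⇒0<n∸m i<j))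

  -- Opaque: only the existence of s matters, and unfolding the proof whenever an
  -- orbit position is inspected makes type checking prohibitively expensive.
  opaque
    orbit-surjective : ∀ y → ∃[ s ] s < n × orbit s ≡ y
    orbit-surjective = period-covers orbit-return (≤-<-trans z≤n (toℕ<n z))

-- The permutations 1 2 … q (m+1) 0 (q+1) … m

data Region (q t : ℕ) : Set where
  before : t < q → Region q t
  peak   : t ≡ q → Region q t
  trough : t ≡ suc q → Region q t
  after  : suc q < t → Region q t

region : ∀ q t → Region q t
region q t with <-cmp t q
... | tri< t<q _ _ = before t<q
... | tri≈ _ t≡q _ = peak t≡q
... | tri> _ _ q<t with m≤n⇒m<n∨m≡n q<t
...   | inj₁ 1+q<t = after 1+q<t
...   | inj₂ 1+q≡t = trough (sym 1+q≡t)

oneLine : (top q t : ℕ) → ℕ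
oneLine top q t with region q t
... | before _ = suc t
... | peak _   = top
... | trough _ = 0
... | after _  = pred t

module _ {top q : ℕ} where

  oneLine-before : ∀ {t} → t < q → oneLine top q t ≡ suc t
  oneLine-before {t} t<q with region q t
  ... | before _    = refl
  ... | peak t≡q    = contradiction t≡q (<⇒≢ t<q)
  ... | trough t≡1+q = contradiction (subst (q ≤_) (sym t≡1+q) (n≤1+n q)) (<⇒≱ t<q)
  ... | after 1+q<t = contradiction t<q (<-asym (<-trans (n<1+n q) 1+q<t))

  oneLine-peak : ∀ {t} → t ≡ q → oneLine top q t ≡ top
  oneLine-peak {t} t≡q with region q t
  ... | before t<q   = contradiction t≡q (<⇒≢ t<q)
  ... | peak _       = refl
  ... | trough t≡1+q = contradiction (trans (sym t≡1+q) t≡q) 1+n≢n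
  ... | after 1+q<t  = contradiction (sym t≡q) (<⇒≢ (<-trans (n<1+n q) 1+q<t))

  oneLine-trough : ∀ {t} → t ≡ suc q → oneLine top q t ≡ 0
  oneLine-trough {t} t≡1+q with region q t
  ... | before t<q  = contradiction (subst (q ≤_) (sym t≡1+q) (n≤1+n q)) (<⇒≱ t<q)
  ... | peak t≡q    = contradiction (trans (sym t≡1+q) t≡q) 1+n≢n
  ... | trough _    = refl
  ... | after 1+q<t = contradiction (sym t≡1+q) (<⇒≢ 1+q<t)

  oneLine-after : ∀ {t} → suc q < t → oneLine top q t ≡ pred t
  oneLine-after {t} 1+q<t with region q t
  ... | before t<q   = contradiction t<q (<-asym (<-trans (n<1+n q) 1+q<t))
  ... | peak t≡q     = contradiction (sym t≡q) (<⇒≢ (<-trans (n<1+n q) 1+q<t))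
  ... | trough t≡1+q = contradiction (sym t≡1+q) (<⇒≢ 1+q<t)
  ... | after _      = refl

-- and their cycle notation 0 1 … q (m+1) m … (q+1), where top = m + 1
cycleEntry : (top q t : ℕ) → ℕ
cycleEntry top q t with t ≤? q
... | yes _ = t
... | no  _ = top + suc q ∸ t

module _ {top q : ℕ} where

  cycleEntry-≤ : ∀ {t} → t ≤ q → cycleEntry top q t ≡ t
  cycleEntry-≤ {t} t≤q with t ≤? q
  ... | yes _   = refl
  ... | no  t≰q = contradiction t≤q t≰q

  cycleEntry-> : ∀ {t} → q < t → cycleEntry top q t ≡ top + suc q ∸ t
  cycleEntry-> {t} q<t with t ≤? q
  ... | yes t≤q = contradiction t≤q (<⇒≱ q<t)
  ... | no  _   = refl

module Family (m : ℕ) where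

  top : ℕ
  top = suc m

  perm : ℕ → Vec (Fin (suc top)) (suc top)
  perm q = tabulate λ i → clamp top (oneLine top q (toℕ i))

  module _ {q : ℕ} (q≤m : q ≤ m) where

    private
      c : ℕ → ℕ
      c = cycleEntry top q

      mirror : ℕ → ℕ
      mirror t = top + suc q ∸ t

      ≤top⇒≤top+1+q : ∀ {t} → t ≤ top → t ≤ top + suc q
      ≤top⇒≤top+1+q t≤top = ≤-trans t≤top (m≤m+n top (suc q))

      mirror-top : mirror top ≡ suc q
      mirror-top = m+n∸m≡n top (suc q)

      1+q≤mirror : ∀ {t} → t ≤ top → suc q ≤ mirror t
      1+q≤mirror {t} t≤top = subst (_≤ mirror t) mirror-top (∸-monoʳ-≤ (top + suc q) t≤top)

      1+q<mirror : ∀ {t} → t < top → suc q < mirror t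
      1+q<mirror {t} t<top = subst (_< mirror t) mirror-top (∸-monoʳ-< t<top (≤top⇒≤top+1+q ≤-refl))

    oneLine-≤top : ∀ {t} → t ≤ top → oneLine top q t ≤ top
    oneLine-≤top {t} t≤top with region q t
    ... | before t<q = ≤-trans t<q (m≤n⇒m≤1+n q≤m)
    ... | peak _     = ≤-refl
    ... | trough _   = z≤n
    ... | after _    = ≤-trans pred[n]≤n t≤top

    perm-value : ∀ i → toℕ (lookup (perm q) i) ≡ oneLine top q (toℕ i)
    perm-value i = trans (cong toℕ (lookup∘tabulate (λ j → clamp top (oneLine top q (toℕ j))) i))
                         (toℕ-clamp (oneLine-≤top (≤-pred (toℕ<n i))))

    cycleEntry-≤top : ∀ {t} → t ≤ top → c t ≤ top
    cycleEntry-≤top {t} t≤top with t ≤? q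
    ... | yes _   = t≤top
    ... | no  t≰q = subst (mirror t ≤_) (m+n∸n≡m top (suc q)) (∸-monoʳ-≤ (top + suc q) (≰⇒> t≰q))

    cycleEntry-involutive : ∀ {t} → t ≤ top → c (c t) ≡ t
    cycleEntry-involutive {t} t≤top with t ≤? q
    ... | yes t≤q = cycleEntry-≤ t≤q
    ... | no  t≰q = trans (cycleEntry-> (1+q≤mirror t≤top)) (m∸[m∸n]≡n (≤top⇒≤top+1+q t≤top))

    cycleEntry-injective : ∀ {s t} → s ≤ top → t ≤ top → c s ≡ c t → s ≡ t
    cycleEntry-injective s≤top t≤top cs≡ct =
      trans (sym (cycleEntry-involutive s≤top)) (trans (cong c cs≡ct) (cycleEntry-involutive t≤top))

    oneLine-step : ∀ {s} → s < top → oneLine top q (c s) ≡ c (suc s)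
    oneLine-step {s} s<top with <-cmp s q
    ... | tri< s<q _ _ = begin
      oneLine top q (c s) ≡⟨ cong (oneLine top q) (cycleEntry-≤ (<⇒≤ s<q)) ⟩
      oneLine top q s     ≡⟨ oneLine-before s<q ⟩
      suc s               ≡⟨ sym (cycleEntry-≤ s<q) ⟩
      c (suc s)           ∎
    ... | tri≈ _ s≡q _ = begin
      oneLine top q (c s) ≡⟨ cong (oneLine top q) (cycleEntry-≤ (≤-reflexive s≡q)) ⟩
      oneLine top q s     ≡⟨ oneLine-peak s≡q ⟩
      top                 ≡⟨ sym (m+n∸n≡m top (suc q)) ⟩
      mirror (suc q)      ≡⟨ cong (mirror ∘ suc) (sym s≡q) ⟩
      mirror (suc s)      ≡⟨ sym (cycleEntry-> (s≤s (≤-reflexive (sym s≡q)))) ⟩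
      c (suc s)           ∎
    ... | tri> _ _ q<s = begin
      oneLine top q (c s)        ≡⟨ cong (oneLine top q) (cycleEntry-> q<s) ⟩
      oneLine top q (mirror s)   ≡⟨ oneLine-after (1+q<mirror s<top) ⟩
      pred (mirror s)            ≡⟨ pred[m∸n]≡m∸[1+n] (top + suc q) s ⟩
      mirror (suc s)             ≡⟨ sym (cycleEntry-> (m<n⇒m<1+n q<s)) ⟩
      c (suc s)                  ∎

    oneLine-wrap : oneLine top q (c top) ≡ 0
    oneLine-wrap = oneLine-trough (trans (cycleEntry-> (s≤s q≤m)) mirror-top)

    private
      step-distinct-from-wrap : ∀ {a} → a < top → oneLine top q (c a) ≢ oneLine top q (c top)
      step-distinct-from-wrap {a} a<top e = 1+n≢0 (cycleEntry-injective a<top z≤n (begin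
        c (suc a)            ≡⟨ sym (oneLine-step a<top) ⟩
        oneLine top q (c a)  ≡⟨ e ⟩
        oneLine top q (c top) ≡⟨ oneLine-wrap ⟩
        0                    ≡⟨ sym (cycleEntry-≤ {top} {q} z≤n) ⟩
        c 0                  ∎))

      step-injective : ∀ {a b} → a ≤ top → b ≤ top → oneLine top q (c a) ≡ oneLine top q (c b) → a ≡ b
      step-injective a≤top b≤top e with m≤n⇒m<n∨m≡n a≤top | m≤n⇒m<n∨m≡n b≤top
      ... | inj₁ a<top | inj₁ b<top = suc-injective (cycleEntry-injective a<top b<top
                                        (trans (sym (oneLine-step a<top)) (trans e (oneLine-step b<top))))
      ... | inj₁ a<top | inj₂ refl  = contradiction e (step-distinct-from-wrap a<top)
      ... | inj₂ refl  | inj₁ b<top = contradiction (sym e) (step-distinct-from-wrap b<top)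
      ... | inj₂ refl  | inj₂ refl  = refl

    -- The permutation is conjugate, by its cycle notation, to t ↦ t + 1 mod (m + 2).
    oneLine-injective : ∀ {i j} → i ≤ top → j ≤ top → oneLine top q i ≡ oneLine top q j → i ≡ j
    oneLine-injective {i} {j} i≤top j≤top e = begin
      i       ≡⟨ sym (cycleEntry-involutive i≤top) ⟩
      c (c i) ≡⟨ cong c (step-injective (cycleEntry-≤top i≤top) (cycleEntry-≤top j≤top) e′) ⟩
      c (c j) ≡⟨ cycleEntry-involutive j≤top ⟩
      j       ∎
      where
      e′ : oneLine top q (c (c i)) ≡ oneLine top q (c (c j))
      e′ = subst₂ (λ x y → oneLine top q x ≡ oneLine top q y)
             (sym (cycleEntry-involutive i≤top)) (sym (cycleEntry-involutive j≤top)) e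

    perm-isPerm : IsPerm (perm q)
    perm-isPerm i j e = toℕ-injective (oneLine-injective (≤-pred (toℕ<n i)) (≤-pred (toℕ<n j))
      (trans (sym (perm-value i)) (trans (cong toℕ e) (perm-value j))))

    perm-orbit : ∀ {t} → t ≤ top → toℕ (iter (lookup (perm q)) t fzero) ≡ c t
    perm-orbit {zero}  _      = sym (cycleEntry-≤ {top} {q} z≤n)
    perm-orbit {suc t} t<top = begin
      toℕ (lookup (perm q) (iter (lookup (perm q)) t fzero))  ≡⟨ perm-value (iter (lookup (perm q)) t fzero) ⟩
      oneLine top q (toℕ (iter (lookup (perm q)) t fzero))    ≡⟨ cong (oneLine top q) (perm-orbit (<⇒≤ t<top)) ⟩
      oneLine top q (c t)                                      ≡⟨ oneLine-step t<top ⟩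
      c (suc t)                                                ∎

    perm-cyclic : IsCyclic (perm q)
    perm-cyclic = returning-orbit⇒cyclic (lookup (perm q)) fzero (suc top) return cover
      where
      return : iter (lookup (perm q)) (suc top) fzero ≡ fzero
      return = toℕ-injective (trans (perm-value (iter (lookup (perm q)) top fzero))
                                    (trans (cong (oneLine top q) (perm-orbit ≤-refl)) oneLine-wrap))
      cover : ∀ y → ∃[ s ] s ≤ suc top × iter (lookup (perm q)) s fzero ≡ y
      cover y = c (toℕ y) , m≤n⇒m≤1+n (cycleEntry-≤top y≤top) ,
                toℕ-injective (trans (perm-orbit (cycleEntry-≤top y≤top)) (cycleEntry-involutive y≤top))
        where y≤top = ≤-pred (toℕ<n y)

    perm-avoids321 : Avoids (perm q) p321
    perm-avoids321 = twoRuns⇒avoids321 (perm q) q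
      (λ i j i<j j≤q → subst₂ _<_ (sym (perm-value i)) (sym (perm-value j)) (rising i<j j≤q))
      (λ i j q<i i<j → subst₂ _<_ (sym (perm-value i)) (sym (perm-value j)) (rising′ q<i i<j))
      where
      rising : ∀ {i j} → i < j → j ≤ q → oneLine top q i < oneLine top q j
      rising {i} {j} i<j j≤q with m≤n⇒m<n∨m≡n j≤q
      ... | inj₁ j<q = subst₂ _<_ (sym (oneLine-before (<-trans i<j j<q))) (sym (oneLine-before j<q)) (s≤s i<j)
      ... | inj₂ j≡q = subst₂ _<_ (sym (oneLine-before (<-≤-trans i<j j≤q))) (sym (oneLine-peak j≡q))
                         (s≤s (≤-trans i<j (≤-trans j≤q q≤m)))
      rising′ : ∀ {i j} → q < i → i < j → oneLine top q i < oneLine top q j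
      rising′ {i} {j} q<i i<j with m≤n⇒m<n∨m≡n q<i
      ... | inj₂ 1+q≡i = subst₂ _<_ (sym (oneLine-trough (sym 1+q≡i))) (sym (oneLine-after 1+q<j))
                           (<-≤-trans z<s (<⇒≤pred 1+q<j))
        where 1+q<j = subst (_< j) (sym 1+q≡i) i<j
      ... | inj₁ 1+q<i = subst₂ _<_ (sym (oneLine-after 1+q<i)) (sym (oneLine-after (<-trans 1+q<i i<j)))
                           (pred-mono-< {{>-nonZero (<-trans z<s 1+q<i)}} i<j)

    cycleNotation-value : ∀ i → toℕ (lookup (cycleNotation (perm q)) i) ≡ c (toℕ i)
    cycleNotation-value i =
      trans (cong toℕ (lookup∘tabulate (λ j → iter (lookup (perm q)) (toℕ j) fzero) i))
            (perm-orbit (≤-pred (toℕ<n i)))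

    perm-cycle-avoids231 : Avoids (cycleNotation (perm q)) p231
    perm-cycle-avoids231 = prefixBelow-suffixDecreasing⇒avoids231 (cycleNotation (perm q)) q
      (λ i k i≤q i<k → subst₂ _<_ (sym (cycleNotation-value i)) (sym (cycleNotation-value k))
                         (prefix-below i≤q i<k (≤-pred (toℕ<n k))))
      (λ j k q<j j<k → subst₂ _<_ (sym (cycleNotation-value k)) (sym (cycleNotation-value j))
                         (suffix-decreasing q<j j<k (≤-pred (toℕ<n k))))
      where
      prefix-below : ∀ {i k} → i ≤ q → i < k → k ≤ top → c i < c k
      prefix-below {i} {k} i≤q i<k k≤top with k ≤? q
      ... | yes _ = subst (_< k) (sym (cycleEntry-≤ i≤q)) i<k
      ... | no  _ = subst (_< mirror k) (sym (cycleEntry-≤ i≤q)) (<-≤-trans (s≤s i≤q) (1+q≤mirror k≤top))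
      suffix-decreasing : ∀ {j k} → q < j → j < k → k ≤ top → c k < c j
      suffix-decreasing q<j j<k k≤top = subst₂ _<_ (sym (cycleEntry-> (<-trans q<j j<k))) (sym (cycleEntry-> q<j))
                                          (∸-monoʳ-< j<k (≤top⇒≤top+1+q k≤top))

    perm-∈A : InA (suc top) p321 p231 (perm q)
    perm-∈A = perm-isPerm , perm-cyclic , perm-avoids321 , perm-cycle-avoids231

  perm-injective : ∀ {a b} → a ≤ m → b ≤ m → perm a ≡ perm b → a ≡ b
  perm-injective {a} {b} a≤m b≤m pa≡pb = oneLine-injective b≤m a≤top (m≤n⇒m≤1+n b≤m) (begin
    oneLine top b a                        ≡⟨ sym (value-at b≤m) ⟩
    toℕ (lookup (perm b) (clamp top a))    ≡⟨ cong (λ v → toℕ (lookup v (clamp top a))) (sym pa≡pb) ⟩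
    toℕ (lookup (perm a) (clamp top a))    ≡⟨ value-at a≤m ⟩
    oneLine top a a                        ≡⟨ oneLine-peak {top} {a} refl ⟩
    top                                    ≡⟨ sym (oneLine-peak {top} {b} refl) ⟩
    oneLine top b b                        ∎)
    where
    a≤top : a ≤ top
    a≤top = m≤n⇒m≤1+n a≤m
    value-at : ∀ {q} → q ≤ m → toℕ (lookup (perm q) (clamp top a)) ≡ oneLine top q a
    value-at {q} q≤m = trans (perm-value {q} q≤m (clamp top a)) (cong (oneLine top q) (toℕ-clamp a≤top))

-- Every member of 𝒜_{m+2}(321;231) belongs to the family

module Classification (m : ℕ) (π : Vec (Fin (suc (suc m))) (suc (suc m)))
  (π-perm : IsPerm π) (π-cyclic : IsCyclic π)
  (π-avoids : Avoids π p321) (Cπ-avoids : Avoids (cycleNotation π) p231) where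

  open Family m using (top; perm; perm-value)

  f : Fin (suc top) → Fin (suc top)
  f = lookup π

  open CyclicOrbit f (π-perm _ _) π-cyclic fzero

  at : ℕ → Fin (suc top)
  at = clamp top

  -- π and C(π) read as sequences of naturals indexed by 0 … top
  V O : ℕ → ℕ
  V t = toℕ (f (at t))
  O k = toℕ (orbit k)

  V≤top : ∀ t → V t ≤ top
  V≤top t = ≤-pred (toℕ<n (f (at t)))

  O≤top : ∀ k → O k ≤ top
  O≤top k = ≤-pred (toℕ<n (orbit k))

  V-injective : ∀ {i j} → i ≤ top → j ≤ top → V i ≡ V j → i ≡ j
  V-injective i≤top j≤top e =
    trans (sym (toℕ-clamp i≤top)) (trans (cong toℕ (π-perm _ _ (toℕ-injective e))) (toℕ-clamp j≤top))

  O-injective : ∀ {i j} → i ≤ top → j ≤ top → O i ≡ O j → i ≡ j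
  O-injective i≤top j≤top e = orbit-injective (s≤s i≤top) (s≤s j≤top) (toℕ-injective e)

  O-surjective : ∀ {t} → t ≤ top → ∃[ s ] s ≤ top × O s ≡ t
  O-surjective {t} t≤top =
    proj₁ c , ≤-pred (proj₁ (proj₂ c)) , trans (cong toℕ (proj₂ (proj₂ c))) (toℕ-clamp t≤top)
    where c = orbit-surjective (at t)

  V∘O : ∀ k → V (O k) ≡ O (suc k)
  V∘O k = cong (toℕ ∘ f) (clamp-toℕ (orbit k))

  private
    at-< : ∀ {i j} → i < j → j ≤ top → toℕ (at i) < toℕ (at j)
    at-< i<j j≤top = subst₂ _<_ (sym (toℕ-clamp (<⇒≤ (<-≤-trans i<j j≤top)))) (sym (toℕ-clamp j≤top)) i<j

    Cπ-value : ∀ {t} → t ≤ top → toℕ (lookup (cycleNotation π) (at t)) ≡ O t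
    Cπ-value {t} t≤top =
      cong toℕ (trans (lookup∘tabulate (λ j → orbit (toℕ j)) (at t)) (cong orbit (toℕ-clamp t≤top)))

  no321 : ∀ {i j k} → i < j → j < k → k ≤ top → V j < V i → V k < V j → ⊥
  no321 i<j j<k k≤top Vj<Vi Vk<Vj = π-avoids (Equivalence.from (contains321⇔ π)
    (at _ , at _ , at _ , at-< i<j (<⇒≤ (<-≤-trans j<k k≤top)) , at-< j<k k≤top , Vj<Vi , Vk<Vj))

  no231 : ∀ {a b c} → a < b → b < c → c ≤ top → O a < O b → O c < O a → ⊥
  no231 {a} {b} {c} a<b b<c c≤top Oa<Ob Oc<Oa = Cπ-avoids (Equivalence.from (contains231⇔ (cycleNotation π))
    (at a , at b , at c , at-< a<b b≤top , at-< b<c c≤top ,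
     subst₂ _<_ (sym (Cπ-value a≤top)) (sym (Cπ-value b≤top)) Oa<Ob ,
     subst₂ _<_ (sym (Cπ-value c≤top)) (sym (Cπ-value a≤top)) Oc<Oa))
    where
    b≤top = <⇒≤ (<-≤-trans b<c c≤top)
    a≤top = <⇒≤ (<-≤-trans a<b b≤top)

  peakIndex : ∃[ κ ] suc κ ≤ top × O (suc κ) ≡ top
  peakIndex with O-surjective {top} ≤-refl
  ... | zero  , _ , ()
  ... | suc κ , 1+κ≤top , Oκ≡top = κ , 1+κ≤top , Oκ≡top

  κ : ℕ
  κ = proj₁ peakIndex

  κ<top : κ < top
  κ<top = proj₁ (proj₂ peakIndex)

  O-peak : O (suc κ) ≡ top
  O-peak = proj₂ (proj₂ peakIndex)

  prefix<top : ∀ {a} → a ≤ κ → O a < top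
  prefix<top {a} a≤κ = ≤∧≢⇒< (O≤top a) λ Oa≡top →
    <⇒≢ (s≤s a≤κ) (O-injective (≤-trans a≤κ (<⇒≤ κ<top)) κ<top (trans Oa≡top (sym O-peak)))

  prefix<suffix : ∀ {a b} → a ≤ κ → suc κ ≤ b → b ≤ top → O a < O b
  prefix<suffix {a} {b} a≤κ κ<b b≤top with m≤n⇒m<n∨m≡n κ<b
  ... | inj₂ 1+κ≡b = subst (O a <_) (trans (sym O-peak) (cong O 1+κ≡b)) (prefix<top a≤κ)
  ... | inj₁ 1+κ<b with <-cmp (O a) (O b)
  ...   | tri< Oa<Ob _ _ = Oa<Ob
  ...   | tri≈ _ Oa≡Ob _ = contradiction (O-injective (≤-trans a≤κ (<⇒≤ κ<top)) b≤top Oa≡Ob)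
                                         (<⇒≢ (<-trans (s≤s a≤κ) 1+κ<b))
  ...   | tri> _ _ Ob<Oa =
    ⊥-elim (no231 (s≤s a≤κ) 1+κ<b b≤top (subst (O a <_) (sym O-peak) (prefix<top a≤κ)) Ob<Oa)

  q p : ℕ
  q = O κ
  p = O top

  V-q : V q ≡ top
  V-q = trans (V∘O κ) O-peak

  V-p : V p ≡ 0
  V-p = trans (V∘O top) (cong toℕ orbit-return)

  q<p : q < p
  q<p = prefix<suffix ≤-refl κ<top ≤-refl

  q≤top : q ≤ top
  q≤top = O≤top κ

  p≤top : p ≤ top
  p≤top = O≤top top

  q≤m : q ≤ m
  q≤m = ≤-pred (≤-trans q<p p≤top)

  V<top : ∀ {t} → t ≤ top → t ≢ q → V t < top
  V<top {t} t≤top t≢q =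
    ≤∧≢⇒< (V≤top t) λ Vt≡top → t≢q (V-injective t≤top q≤top (trans Vt≡top (sym V-q)))

  0<V : ∀ {t} → t ≤ top → t ≢ p → 0 < V t
  0<V t≤top t≢p =
    ≤∧≢⇒< z≤n λ 0≡Vt → t≢p (V-injective t≤top p≤top (trans (sym 0≡Vt) (sym V-p)))

  p≡1+q : p ≡ suc q
  p≡1+q with m≤n⇒m<n∨m≡n q<p
  ... | inj₂ 1+q≡p = sym 1+q≡p
  ... | inj₁ 1+q<p = ⊥-elim (no321 (n<1+n q) 1+q<p p≤top
                       (subst (V (suc q) <_) (sym V-q) (V<top 1+q≤top 1+n≢n))
                       (subst (_< V (suc q)) (sym V-p) (0<V 1+q≤top (<⇒≢ 1+q<p))))
    where 1+q≤top = ≤-trans (<⇒≤ 1+q<p) p≤top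

  ascent : ∀ {t} → t < top → ¬ (V (suc t) < V t) → V t < V (suc t)
  ascent {t} t<top no-descent with <-cmp (V t) (V (suc t))
  ... | tri< Vt<V1+t _ _ = Vt<V1+t
  ... | tri≈ _ Vt≡V1+t _ = contradiction (V-injective (<⇒≤ t<top) t<top Vt≡V1+t) (1+n≢n ∘ sym)
  ... | tri> _ _ V1+t<Vt = contradiction V1+t<Vt no-descent

  -- A descent before p becomes a 321 together with π(p) = 0, one after q together with π(q) = top.
  increasing-before : ∀ {t} → t < q → V t < V (suc t)
  increasing-before {t} t<q = ascent 1+t≤top λ descent →
    no321 (n<1+n t) 1+t<p p≤top descent (subst (_< V (suc t)) (sym V-p) (0<V 1+t≤top (<⇒≢ 1+t<p)))
    where
    1+t<p : suc t < p
    1+t<p = ≤-<-trans t<q q<p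
    1+t≤top : suc t ≤ top
    1+t≤top = ≤-trans (<⇒≤ 1+t<p) p≤top

  increasing-after : ∀ {t} → q < t → t < top → V t < V (suc t)
  increasing-after {t} q<t t<top = ascent t<top λ descent →
    no321 q<t (n<1+n t) t<top (subst (V t <_) (sym V-q) (V<top (<⇒≤ t<top) (<⇒≢ q<t ∘ sym))) descent

  -- An entry t < q of C(π) precedes top there, and so does the next entry π(t).
  before-≤q : ∀ {t} → t < q → V t ≤ q
  before-≤q {t} t<q with O-surjective (≤-trans (<⇒≤ t<q) q≤top)
  ... | s , s≤top , Os≡t with <-cmp s κ
  ...   | tri< s<κ _ _ =
    ≤-pred (subst₂ _<_ (trans (sym (V∘O s)) (cong V Os≡t)) p≡1+q (prefix<suffix s<κ κ<top ≤-refl))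
  ...   | tri≈ _ s≡κ _ = contradiction (trans (sym Os≡t) (cong O s≡κ)) (<⇒≢ t<q)
  ...   | tri> _ _ κ<s = contradiction (subst (q <_) Os≡t (prefix<suffix ≤-refl κ<s s≤top)) (<-asym t<q)

  V-before : ∀ {t} → t < q → V t ≡ suc t
  V-before = increasing-translation V 1 q (λ i 1+i<q → increasing-before (<-trans (n<1+n i) 1+i<q))
             (λ i i<q → 0<V (≤-trans (<⇒≤ i<q) q≤top) (<⇒≢ (<-trans i<q q<p)))
             (λ i i<q → s≤s (before-≤q i<q)) _

  -- The values 1 … q are taken before q, so the positions after p = q + 1 take values above q.
  after-≥1+q : ∀ {t} → suc q < t → t ≤ top → suc q ≤ V t
  after-≥1+q {t} 1+q<t t≤top with V t in Vt≡
  ... | zero = contradiction (sym Vt≡) (<⇒≢ (0<V t≤top (<⇒≢ (subst (_< t) (sym p≡1+q) 1+q<t) ∘ sym)))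
  ... | suc u with u <? q
  ...   | no  u≮q = s≤s (≮⇒≥ u≮q)
  ...   | yes u<q =
    contradiction (V-injective (≤-trans (<⇒≤ u<q) q≤top) t≤top (trans (V-before u<q) (sym Vt≡)))
                  (<⇒≢ (<-trans u<q (<-trans (n<1+n q) 1+q<t)))

  private
    after-position≤top : ∀ {i} → i < m ∸ q → suc (suc q) + i ≤ top
    after-position≤top {i} i<len = subst (_≤ top) (cong suc (+-suc q i))
      (s≤s (subst (q + suc i ≤_) (m+[n∸m]≡n q≤m) (+-monoʳ-≤ q i<len)))

    q<after-position : ∀ i → q < suc (suc q) + i
    q<after-position i = s≤s (≤-trans (n≤1+n q) (m≤m+n (suc q) i))

  V-after-shifted : ∀ i → i < m ∸ q → V (suc (suc q) + i) ≡ suc q + i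
  V-after-shifted = increasing-translation (λ i → V (suc (suc q) + i)) (suc q) (m ∸ q)
    (λ i 1+i<len → subst (λ x → V (suc (suc q) + i) < V x) (sym (+-suc (suc (suc q)) i))
                     (increasing-after (q<after-position i)
                       (subst (_≤ top) (+-suc (suc (suc q)) i) (after-position≤top 1+i<len))))
    (λ i i<len → after-≥1+q (s≤s (s≤s (m≤m+n q i))) (after-position≤top i<len))
    (λ i i<len → subst (V (suc (suc q) + i) <_) (sym (cong suc (m+[n∸m]≡n q≤m)))
                   (V<top (after-position≤top i<len) (<⇒≢ (q<after-position i) ∘ sym)))

  V-after : ∀ {t} → suc q < t → t ≤ top → V t ≡ pred t
  V-after {t} 1+q<t t≤top = begin
    V t                 ≡⟨ cong V (sym t≡) ⟩
    V (suc (suc q) + i) ≡⟨ V-after-shifted i i<len ⟩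
    suc q + i           ≡⟨ cong pred t≡ ⟩
    pred t              ∎
    where
    i : ℕ
    i = t ∸ suc (suc q)
    t≡ : suc (suc q) + i ≡ t
    t≡ = m+[n∸m]≡n 1+q<t
    i<len : i < m ∸ q
    i<len = +-cancelˡ-≤ q (suc i) (m ∸ q) (subst₂ _≤_ (sym (+-suc q i)) (sym (m+[n∸m]≡n q≤m))
              (≤-pred (subst (_≤ top) (sym t≡) t≤top)))

  V≡oneLine : ∀ {t} → t ≤ top → V t ≡ oneLine top q t
  V≡oneLine {t} t≤top with region q t
  ... | before t<q   = V-before t<q
  ... | peak t≡q     = trans (cong V t≡q) V-q
  ... | trough t≡1+q = trans (cong V (trans t≡1+q (sym p≡1+q))) V-p
  ... | after 1+q<t  = V-after 1+q<t t≤top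

  π≡perm : π ≡ perm q
  π≡perm = lookup-ext λ i → toℕ-injective (begin
    toℕ (f i)              ≡⟨ cong (toℕ ∘ f) (sym (clamp-toℕ i)) ⟩
    V (toℕ i)              ≡⟨ V≡oneLine (≤-pred (toℕ<n i)) ⟩
    oneLine top q (toℕ i)  ≡⟨ sym (perm-value q≤m i) ⟩
    toℕ (lookup (perm q) i) ∎)

theorem4p20 : (n : ℕ) → 2 ≤ n → HasCardinality (InA n p321 p231) (n ∸ 1)
theorem4p20 (suc (suc m)) (s≤s (s≤s z≤n)) =
  map member (allFin (suc m)) ,
  map⁺ member-injective (allFin⁺ (suc m)) ,
  (λ π → mk⇔ (sound π) (complete π)) ,
  trans (length-map member (allFin (suc m))) (length-tabulate {n = suc m} (λ Q → Q))
  where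
  open Family m

  member : Fin (suc m) → Vec (Fin (suc top)) (suc top)
  member Q = perm (toℕ Q)

  member-injective : ∀ {Q R} → member Q ≡ member R → Q ≡ R
  member-injective {Q} {R} = toℕ-injective ∘ perm-injective (≤-pred (toℕ<n Q)) (≤-pred (toℕ<n R))

  sound : ∀ π → π ∈ map member (allFin (suc m)) → InA (suc top) p321 p231 π
  sound π π∈ with ∈-map⁻ member {xs = allFin (suc m)} π∈
  ... | Q , _ , refl = perm-∈A (≤-pred (toℕ<n Q))

  complete : ∀ π → InA (suc top) p321 p231 π → π ∈ map member (allFin (suc m))
  complete π (π-perm , π-cyclic , π-avoids , Cπ-avoids) =
    subst (_∈ map member (allFin (suc m))) (trans (cong perm (toℕ-fromℕ< (s≤s q≤m))) (sym π≡perm))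
      (∈-map⁺ member (∈-allFin (fromℕ< (s≤s q≤m))))
    where open Classification m π π-perm π-cyclic π-avoids Cπ-avoids
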